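{- Let $\mathbb{K}\subseteq\mathbb{DN}$. If $\mathbb{PL}\subseteq\mathbb{K}$ or $\mathbb{DM}\subseteq\mathbb{K}$, then $\vdash^{\top}_{\mathbb{K}}$ (and, a fortiori, $\vdash^{\leq}_{\mathbb{K}}$) is not protoalgebraic.
   Context: Language: binary $\land,\lor$, unary $\neg$, constants $\bot,\top$. $\mathbb{DN}$ is the variety of algebras $\langle A;\land,\lor,\neg,\bot,\top\rangle$ with bounded distributive lattice reduct satisfying $\neg\bot\approx\top$ and $\neg(x\lor y)\approx\neg x\land\neg y$. $\mathbb{SDM}$ is its subvariety given additionally by $\neg\top\approx\bot$, $\neg\neg(x\land y)\approx\neg\neg x\land\neg\neg y$, $\neg x\approx\neg\neg\neg x$; $\mathbb{DM}$ is the subvariety of $\mathbb{SDM}$ given by $\neg\neg x\approx x$; $\mathbb{PL}$ (pseudo-complemented distributive lattices) is the subvariety of $\mathbb{SDM}$ given by $x\land\neg(x\land y)\approx x\land\neg y$. For a class $\mathbb{K}$: $\Gamma\vdash^{\leq}_{\mathbb{K}}\varphi$ iff for all $\mathbf{A}\in\mathbb{K}$, all non-empty lattice filters $F$ and all homomorphisms $h$ from the formula algebra to $\mathbf{A}$, $h[\Gamma]\subseteq F$ implies $h(\varphi)\in F$; $\vdash^{\top}_{\mathbb{K}}$ is the logic defined by the matrices $\langle\mathbf{A},\{\top\}\rangle$, $\mathbf{A}\in\mathbb{K}$ (same definition with $F=\{\top\}$). A logic $\vdash$ is protoalgebraic if there is a set $\Delta(p,q)$ of formulas in at most two variables $p,q$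 such that $\vdash\delta(p,p)$ for all $\delta\in\Delta$ and $p,\Delta(p,q)\vdash q$. -}

module Defs where

open import Level using (Level; _⊔_; suc; 0ℓ)
open import Data.Nat using (ℕ)
open import Data.Product using (Σ; _×_)
open import Data.Sum using (_⊎_)
open import Data.Empty using (⊥)
open import Relation.Nullary using (¬_)
open import Relation.Unary using (Pred; _∈_)
open import Relation.Binary.PropositionalEquality using (_≡_)
open import Algebra.Core using (Op₁; Op₂)
open import Algebra.Lattice.Structures using (IsDistributiveLattice)

record DNAlg (a : Level) : Set (suc a) where
  field
    Carrier : Set a
    _∧ₐ_ _∨ₐ_ : Op₂ Carrier
    ¬ₐ : Op₁ Carrier
    ⊥ₐ ⊤ₐ : Carrier
    isDistributiveLattice : IsDistributiveLattice _≡_ _∨ₐ_ _∧ₐ_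
    ∨-identity-⊥ : ∀ x → x ∨ₐ ⊥ₐ ≡ x
    ∧-identity-⊤ : ∀ x → x ∧ₐ ⊤ₐ ≡ x
    ¬⊥≡⊤ : ¬ₐ ⊥ₐ ≡ ⊤ₐ
    ¬-∨ : ∀ x y → ¬ₐ (x ∨ₐ y) ≡ ¬ₐ x ∧ₐ ¬ₐ y

module _ {a : Level} (A : DNAlg a) where
  open DNAlg A

  record IsSDM : Set a where
    field
      ¬⊤≡⊥ : ¬ₐ ⊤ₐ ≡ ⊥ₐ
      ¬¬-∧ : ∀ x y → ¬ₐ (¬ₐ (x ∧ₐ y)) ≡ ¬ₐ (¬ₐ x) ∧ₐ ¬ₐ (¬ₐ y)
      ¬¬¬ : ∀ x → ¬ₐ x ≡ ¬ₐ (¬ₐ (¬ₐ x))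

  record IsDM : Set a where
    field
      sdm : IsSDM
      ¬¬-involutive : ∀ x → ¬ₐ (¬ₐ x) ≡ x

  record IsPL : Set a where
    field
      sdm : IsSDM
      pc : ∀ x y → x ∧ₐ ¬ₐ (x ∧ₐ y) ≡ x ∧ₐ ¬ₐ y

  _≤ₐ_ : Carrier → Carrier → Set a
  x ≤ₐ y = x ∧ₐ y ≡ x

  record IsFilter (F : Pred Carrier a) : Set a where
    field
      nonEmpty : Σ Carrier (λ x → x ∈ F)
      upClosed : ∀ {x y} → x ∈ F → x ≤ₐ y → y ∈ F
      ∧-closed : ∀ {x y} → x ∈ F → y ∈ F → (x ∧ₐ y) ∈ F

data Fm : Set where
  var : ℕ → Fm
  _∧ᶠ_ _∨ᶠ_ : Fm → Fm → Fm
  ¬ᶠ : Fm → Fm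
  ⊥ᶠ ⊤ᶠ : Fm

-- homomorphisms from the formula algebra = extensions of valuations
eval : ∀ {a} (A : DNAlg a) → (ℕ → DNAlg.Carrier A) → Fm → DNAlg.Carrier A
eval A v (var n) = v n
eval A v (φ ∧ᶠ ψ) = DNAlg._∧ₐ_ A (eval A v φ) (eval A v ψ)
eval A v (φ ∨ᶠ ψ) = DNAlg._∨ₐ_ A (eval A v φ) (eval A v ψ)
eval A v (¬ᶠ φ) = DNAlg.¬ₐ A (eval A v φ)
eval A v ⊥ᶠ = DNAlg.⊥ₐ A
eval A v ⊤ᶠ = DNAlg.⊤ₐ A

FmSet : Set₁
FmSet = Pred Fm 0ℓ

Logic : (ℓ : Level) → Set (suc ℓ)
Logic ℓ = FmSet → Fm → Set ℓ

-- A class of DN-algebras (K ⊆ DN is built in)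
Class : (a k : Level) → Set (suc a ⊔ suc k)
Class a k = DNAlg a → Set k

_⊆ᶜ_ : ∀ {a k k'} → Class a k → Class a k' → Set (suc a ⊔ k ⊔ k')
K ⊆ᶜ L = ∀ A → K A → L A

PLᶜ DMᶜ : ∀ {a} → Class a a
PLᶜ A = IsPL A
DMᶜ A = IsDM A

⊢≤ : ∀ {a k} → Class a k → Logic (suc a ⊔ k)
⊢≤ {a} K Γ φ = ∀ (A : DNAlg a) → K A → (F : Pred (DNAlg.Carrier A) a) → IsFilter A F →
  (v : ℕ → DNAlg.Carrier A) → (∀ γ → γ ∈ Γ → eval A v γ ∈ F) → eval A v φ ∈ F

⊢⊤ : ∀ {a k} → Class a k → Logic (suc a ⊔ k)
⊢⊤ {a} K Γ φ = ∀ (A : DNAlg a) → K A → (v : ℕ → DNAlg.Carrier A) →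
  (∀ γ → γ ∈ Γ → eval A v γ ≡ DNAlg.⊤ₐ A) → eval A v φ ≡ DNAlg.⊤ₐ A

p q : Fm
p = var 0
q = var 1

data InPQ : Fm → Set where
  v0 : InPQ (var 0)
  v1 : InPQ (var 1)
  and : ∀ {φ ψ} → InPQ φ → InPQ ψ → InPQ (φ ∧ᶠ ψ)
  or : ∀ {φ ψ} → InPQ φ → InPQ ψ → InPQ (φ ∨ᶠ ψ)
  neg : ∀ {φ} → InPQ φ → InPQ (¬ᶠ φ)
  bot : InPQ ⊥ᶠ
  top : InPQ ⊤ᶠ

sub : (ℕ → Fm) → Fm → Fm
sub σ (var n) = σ n
sub σ (φ ∧ᶠ ψ) = sub σ φ ∧ᶠ sub σ ψ
sub σ (φ ∨ᶠ ψ) = sub σ φ ∨ᶠ sub σ ψ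
sub σ (¬ᶠ φ) = ¬ᶠ (sub σ φ)
sub σ ⊥ᶠ = ⊥ᶠ
sub σ ⊤ᶠ = ⊤ᶠ

-- δ(p,p): substitute p for q (all other variables fixed)
qp : ℕ → Fm
qp 1 = p
qp n = var n

∅ : FmSet
∅ _ = ⊥

p∪ : FmSet → FmSet
p∪ Δ φ = (φ ≡ p) ⊎ Δ φ

Protoalgebraic : ∀ {ℓ} → Logic ℓ → Set (suc 0ℓ ⊔ ℓ)
Protoalgebraic _⊢_ = Σ FmSet λ Δ →
  (∀ δ → δ ∈ Δ → InPQ δ) ×
  (∀ δ → δ ∈ Δ → ∅ ⊢ sub qp δ) ×
  (p∪ Δ ⊢ q)

-- Suppose R is a relation on some A ∈ K that is compatible with all operations and
-- reflects ⊤ (R x ⊤ implies x = ⊤), and that R ⊤ c and R b c for some b ≠ ⊤. Send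
-- (p, q) to (⊤, b) by w and to (c, c) by v. Every δ(p, q) ∈ Δ is true under v because
-- δ(p, p) is a theorem, hence true under w because R relates w(δ) to v(δ) = ⊤; so
-- p, Δ(p, q) ⊢ q would give b = ⊤. Such data exist on the three-element chain with the
-- pseudo-complement (a PL-algebra) and with the Kleene negation (a DM-algebra). The
-- order-based logic ⊢≤ is weaker than ⊢⊤, since {⊤} is a filter, so it cannot be
-- protoalgebraic either.
module Submission where

open import Level using (Level; _⊔_)
open import Function using (_∘_; const)
open import Data.Nat using (ℕ; zero; suc)
open import Data.Product using (_×_; _,_)
open import Data.Sum using (_⊎_; inj₁; inj₂; [_,_])
open import Relation.Nullary using (¬_; Dec; yes; no)
open import Relation.Nullary.Decidable
  using (map′; from-yes; _×-dec_; _⊎-dec_; _→-dec_)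
open import Relation.Binary.Core using (Rel; _Preserves_⟶_; _Preserves₂_⟶_⟶_)
open import Relation.Binary.Definitions using (DecidableEquality; Decidable)
open import Relation.Binary.PropositionalEquality
  using (_≡_; _≢_; refl; sym; trans; cong; cong₂; subst; isEquivalence; module ≡-Reasoning)
open import Algebra.Core using (Op₁; Op₂)
open import Algebra.Lattice.Structures using (IsDistributiveLattice)

open import Defs

module _ {a : Level} (A : DNAlg a) where
  open DNAlg A

  record Compatible {ℓ} (R : Rel Carrier ℓ) : Set (a ⊔ ℓ) where
    field
      ∧-preserves : _∧ₐ_ Preserves₂ R ⟶ R ⟶ R
      ∨-preserves : _∨ₐ_ Preserves₂ R ⟶ R ⟶ R
      ¬-preserves : ¬ₐ Preserves R ⟶ R
      ⊥-related : R ⊥ₐ ⊥ₐ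
      ⊤-related : R ⊤ₐ ⊤ₐ

  ≡-compatible : Compatible _≡_
  ≡-compatible = record
    { ∧-preserves = cong₂ _∧ₐ_
    ; ∨-preserves = cong₂ _∨ₐ_
    ; ¬-preserves = cong ¬ₐ
    ; ⊥-related = refl
    ; ⊤-related = refl
    }

  eval-preserves : ∀ {ℓ} {R : Rel Carrier ℓ} → Compatible R →
                   ∀ {w v} → (∀ n → R (w n) (v n)) → ∀ φ → R (eval A w φ) (eval A v φ)
  eval-preserves R-compat {w} {v} wRv = go
    where
    open Compatible R-compat
    go : ∀ φ → _
    go (var n) = wRv n
    go (φ ∧ᶠ ψ) = ∧-preserves (go φ) (go ψ)
    go (φ ∨ᶠ ψ) = ∨-preserves (go φ) (go ψ)
    go (¬ᶠ φ) = ¬-preserves (go φ)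
    go ⊥ᶠ = ⊥-related
    go ⊤ᶠ = ⊤-related

  eval-cong : ∀ {w v} → (∀ n → w n ≡ v n) → ∀ φ → eval A w φ ≡ eval A v φ
  eval-cong = eval-preserves ≡-compatible

  eval-sub : ∀ v σ φ → eval A v (sub σ φ) ≡ eval A (eval A v ∘ σ) φ
  eval-sub v σ (var n) = refl
  eval-sub v σ (φ ∧ᶠ ψ) = cong₂ _∧ₐ_ (eval-sub v σ φ) (eval-sub v σ ψ)
  eval-sub v σ (φ ∨ᶠ ψ) = cong₂ _∨ₐ_ (eval-sub v σ φ) (eval-sub v σ ψ)
  eval-sub v σ (¬ᶠ φ) = cong ¬ₐ (eval-sub v σ φ)
  eval-sub v σ ⊥ᶠ = refl
  eval-sub v σ ⊤ᶠ = refl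

  eval-const-sub-qp : ∀ c φ → eval A (const c) (sub qp φ) ≡ eval A (const c) φ
  eval-const-sub-qp c φ = trans (eval-sub (const c) qp φ) (eval-cong qp-const φ)
    where
    qp-const : ∀ n → eval A (const c) (qp n) ≡ c
    qp-const zero = refl
    qp-const (suc zero) = refl
    qp-const (suc (suc n)) = refl

  ⊤-isFilter : IsFilter A (_≡ ⊤ₐ)
  ⊤-isFilter = record
    { nonEmpty = ⊤ₐ , refl
    ; upClosed = λ { {y = y} refl ⊤∧y≡⊤ → begin
        y        ≡⟨ sym (∧-identity-⊤ y) ⟩
        y ∧ₐ ⊤ₐ  ≡⟨ ∧-comm y ⊤ₐ ⟩
        ⊤ₐ ∧ₐ y  ≡⟨ ⊤∧y≡⊤ ⟩
        ⊤ₐ       ∎ }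
    ; ∧-closed = λ { refl refl → ∧-identity-⊤ ⊤ₐ }
    }
    where
    open ≡-Reasoning
    open IsDistributiveLattice isDistributiveLattice using (∧-comm)

⊢≤⇒⊢⊤ : ∀ {a k} (K : Class a k) Γ φ → ⊢≤ K Γ φ → ⊢⊤ K Γ φ
⊢≤⇒⊢⊤ K Γ φ Γ⊢φ A A∈K = Γ⊢φ A A∈K (_≡ DNAlg.⊤ₐ A) (⊤-isFilter A)

Protoalgebraic-mono : ∀ {ℓ₁ ℓ₂} {_⊢₁_ : Logic ℓ₁} {_⊢₂_ : Logic ℓ₂} →
                      (∀ Γ φ → Γ ⊢₁ φ → Γ ⊢₂ φ) →
                      Protoalgebraic _⊢₁_ → Protoalgebraic _⊢₂_
Protoalgebraic-mono ⊢₁⊆⊢₂ (Δ , Δ-in-pq , Δ-refl , Δ-mp) =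
  Δ , Δ-in-pq , (λ δ δ∈Δ → ⊢₁⊆⊢₂ ∅ (sub qp δ) (Δ-refl δ δ∈Δ)) , ⊢₁⊆⊢₂ (p∪ Δ) q Δ-mp

module _ {a k} {K : Class a k} {A : DNAlg a} (A∈K : K A) where
  open DNAlg A

  ¬Protoalgebraic-⊢⊤-by-relation :
    ∀ {ℓ} {R : Rel Carrier ℓ} → Compatible A R → (∀ {x} → R x ⊤ₐ → x ≡ ⊤ₐ) →
    (b c : Carrier) → R ⊤ₐ c → R b c → b ≢ ⊤ₐ → ¬ Protoalgebraic (⊢⊤ K)
  ¬Protoalgebraic-⊢⊤-by-relation {R = R} R-compat R-reflects-⊤ b c ⊤Rc bRc b≢⊤
    (Δ , _ , Δ-refl , Δ-mp) = b≢⊤ (Δ-mp A A∈K w w⊨p∪Δ)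
    where
    w : ℕ → Carrier
    w zero = ⊤ₐ
    w (suc _) = b

    wRc : ∀ n → R (w n) c
    wRc zero = ⊤Rc
    wRc (suc _) = bRc

    const-c⊨Δ : ∀ δ → Δ δ → eval A (const c) δ ≡ ⊤ₐ
    const-c⊨Δ δ δ∈Δ =
      trans (sym (eval-const-sub-qp A c δ)) (Δ-refl δ δ∈Δ A A∈K (const c) (λ _ ()))

    w⊨p∪Δ : ∀ γ → p∪ Δ γ → eval A w γ ≡ ⊤ₐ
    w⊨p∪Δ γ (inj₁ refl) = refl
    w⊨p∪Δ γ (inj₂ γ∈Δ) =
      R-reflects-⊤ (subst (R (eval A w γ)) (const-c⊨Δ γ γ∈Δ) (eval-preserves A R-compat wRc γ))

data Three (a : Level) : Set a where
  lo mid hi : Three a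

module _ {a : Level} where

  infix 4 _≟_

  _≟_ : DecidableEquality (Three a)
  lo ≟ lo = yes refl
  lo ≟ mid = no λ ()
  lo ≟ hi = no λ ()
  mid ≟ lo = no λ ()
  mid ≟ mid = yes refl
  mid ≟ hi = no λ ()
  hi ≟ lo = no λ ()
  hi ≟ mid = no λ ()
  hi ≟ hi = yes refl

  every : ∀ {b} {P : Three a → Set b} → (∀ x → Dec (P x)) → Dec (∀ x → P x)
  every P? = map′ (λ { (Plo , Pmid , Phi) → λ { lo → Plo ; mid → Pmid ; hi → Phi } })
                  (λ ∀P → ∀P lo , ∀P mid , ∀P hi)
                  (P? lo ×-dec P? mid ×-dec P? hi)

  infixr 7 _⊓₃_
  infixr 6 _⊔₃_

  _⊓₃_ _⊔₃_ : Op₂ (Three a)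
  lo ⊓₃ _ = lo
  mid ⊓₃ lo = lo
  mid ⊓₃ _ = mid
  hi ⊓₃ y = y

  lo ⊔₃ y = y
  mid ⊔₃ hi = hi
  mid ⊔₃ _ = mid
  hi ⊔₃ _ = hi

  pseudocomplement kleene : Op₁ (Three a)
  pseudocomplement lo = hi
  pseudocomplement _ = lo

  kleene lo = hi
  kleene mid = mid
  kleene hi = lo

  isDistributiveLattice₃ : IsDistributiveLattice _≡_ _⊔₃_ _⊓₃_
  isDistributiveLattice₃ = record
    { isLattice = record
      { isEquivalence = isEquivalence
      ; ∨-comm = from-yes (every λ x → every λ y → x ⊔₃ y ≟ y ⊔₃ x)
      ; ∨-assoc = from-yes (every λ x → every λ y → every λ z → (x ⊔₃ y) ⊔₃ z ≟ x ⊔₃ (y ⊔₃ z))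
      ; ∨-cong = cong₂ _⊔₃_
      ; ∧-comm = from-yes (every λ x → every λ y → x ⊓₃ y ≟ y ⊓₃ x)
      ; ∧-assoc = from-yes (every λ x → every λ y → every λ z → (x ⊓₃ y) ⊓₃ z ≟ x ⊓₃ (y ⊓₃ z))
      ; ∧-cong = cong₂ _⊓₃_
      ; absorptive = from-yes (every λ x → every λ y → x ⊔₃ (x ⊓₃ y) ≟ x)
                   , from-yes (every λ x → every λ y → x ⊓₃ (x ⊔₃ y) ≟ x)
      }
    ; ∨-distrib-∧ = from-yes (every λ x → every λ y → every λ z → x ⊔₃ (y ⊓₃ z) ≟ (x ⊔₃ y) ⊓₃ (x ⊔₃ z))
                  , from-yes (every λ x → every λ y → every λ z → (y ⊓₃ z) ⊔₃ x ≟ (y ⊔₃ x) ⊓₃ (z ⊔₃ x))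
    ; ∧-distrib-∨ = from-yes (every λ x → every λ y → every λ z → x ⊓₃ (y ⊔₃ z) ≟ (x ⊓₃ y) ⊔₃ (x ⊓₃ z))
                  , from-yes (every λ x → every λ y → every λ z → (y ⊔₃ z) ⊓₃ x ≟ (y ⊓₃ x) ⊔₃ (z ⊓₃ x))
    }

  chain₃ : (¬₃ : Op₁ (Three a)) → ¬₃ lo ≡ hi →
           (∀ x y → ¬₃ (x ⊔₃ y) ≡ ¬₃ x ⊓₃ ¬₃ y) → DNAlg a
  chain₃ ¬₃ ¬₃-lo ¬₃-⊔ = record
    { Carrier = Three a
    ; _∧ₐ_ = _⊓₃_
    ; _∨ₐ_ = _⊔₃_
    ; ¬ₐ = ¬₃
    ; ⊥ₐ = lo
    ; ⊤ₐ = hi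
    ; isDistributiveLattice = isDistributiveLattice₃
    ; ∨-identity-⊥ = from-yes (every λ x → x ⊔₃ lo ≟ x)
    ; ∧-identity-⊤ = from-yes (every λ x → x ⊓₃ hi ≟ x)
    ; ¬⊥≡⊤ = ¬₃-lo
    ; ¬-∨ = ¬₃-⊔
    }

  PL₃ K₃ : DNAlg a
  PL₃ = chain₃ pseudocomplement refl
    (from-yes (every λ x → every λ y →
      pseudocomplement (x ⊔₃ y) ≟ pseudocomplement x ⊓₃ pseudocomplement y))
  K₃ = chain₃ kleene refl
    (from-yes (every λ x → every λ y → kleene (x ⊔₃ y) ≟ kleene x ⊓₃ kleene y))

  PL₃-isPL : IsPL PL₃
  PL₃-isPL = record
    { sdm = record
      { ¬⊤≡⊥ = refl
      ; ¬¬-∧ = from-yes (every λ x → every λ y →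
          ∼ (∼ (x ⊓₃ y)) ≟ ∼ (∼ x) ⊓₃ ∼ (∼ y))
      ; ¬¬¬ = from-yes (every λ x → ∼ x ≟ ∼ (∼ (∼ x)))
      }
    ; pc = from-yes (every λ x → every λ y → x ⊓₃ ∼ (x ⊓₃ y) ≟ x ⊓₃ ∼ y)
    }
    where
    ∼ = pseudocomplement

  K₃-isDM : IsDM K₃
  K₃-isDM = record
    { sdm = record
      { ¬⊤≡⊥ = refl
      ; ¬¬-∧ = from-yes (every λ x → every λ y →
          kleene (kleene (x ⊓₃ y)) ≟ kleene (kleene x) ⊓₃ kleene (kleene y))
      ; ¬¬¬ = from-yes (every λ x → kleene x ≟ kleene (kleene (kleene x)))
      }
    ; ¬¬-involutive = from-yes (every λ x → kleene (kleene x) ≟ x)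
    }

  module _ {ℓ} {R : Rel (Three a) ℓ} (R? : Decidable R) where

    preserves₂? : (f : Op₂ (Three a)) → Dec (∀ x y u v → R x y → R u v → R (f x u) (f y v))
    preserves₂? f = every λ x → every λ y → every λ u → every λ v →
      R? x y →-dec R? u v →-dec R? (f x u) (f y v)

    preserves? : (f : Op₁ (Three a)) → Dec (∀ x y → R x y → R (f x) (f y))
    preserves? f = every λ x → every λ y → R? x y →-dec R? (f x) (f y)

  -- x and y differ at most by x = hi, y = mid.
  _≥ᵖ_ : Rel (Three a) a
  x ≥ᵖ y = y ⊓₃ x ≡ y × pseudocomplement x ≡ pseudocomplement y

  _≥ᵖ?_ : Decidable _≥ᵖ_
  x ≥ᵖ? y = (y ⊓₃ x ≟ y) ×-dec (pseudocomplement x ≟ pseudocomplement y)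

  ≥ᵖ-compatible : Compatible PL₃ _≥ᵖ_
  ≥ᵖ-compatible = record
    { ∧-preserves = λ {x y u v} → from-yes (preserves₂? _≥ᵖ?_ _⊓₃_) x y u v
    ; ∨-preserves = λ {x y u v} → from-yes (preserves₂? _≥ᵖ?_ _⊔₃_) x y u v
    ; ¬-preserves = λ {x y} → from-yes (preserves? _≥ᵖ?_ pseudocomplement) x y
    ; ⊥-related = refl , refl
    ; ⊤-related = refl , refl
    }

  -- The information order, with mid the undetermined value; Kleene's connectives are
  -- monotone for it.
  _⊒_ : Rel (Three a) a
  x ⊒ y = x ≡ y ⊎ y ≡ mid

  _⊒?_ : Decidable _⊒_
  x ⊒? y = (x ≟ y) ⊎-dec (y ≟ mid)

  ⊒-compatible : Compatible K₃ _⊒_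
  ⊒-compatible = record
    { ∧-preserves = λ {x y u v} → from-yes (preserves₂? _⊒?_ _⊓₃_) x y u v
    ; ∨-preserves = λ {x y u v} → from-yes (preserves₂? _⊒?_ _⊔₃_) x y u v
    ; ¬-preserves = λ {x y} → from-yes (preserves? _⊒?_ kleene) x y
    ; ⊥-related = inj₁ refl
    ; ⊤-related = inj₁ refl
    }

theorem6p1 : ∀ {a k : Level} (K : Class a k) →
    (PLᶜ ⊆ᶜ K) ⊎ (DMᶜ ⊆ᶜ K) →
    ¬ Protoalgebraic (⊢⊤ K) × ¬ Protoalgebraic (⊢≤ K)
theorem6p1 K PL⊆K⊎DM⊆K = ¬proto-⊢⊤ , ¬proto-⊢⊤ ∘ Protoalgebraic-mono (⊢≤⇒⊢⊤ K)
  where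
  ¬proto-⊢⊤ : ¬ Protoalgebraic (⊢⊤ K)
  ¬proto-⊢⊤ = [ PL-case , DM-case ] PL⊆K⊎DM⊆K
    where
    PL-case : PLᶜ ⊆ᶜ K → ¬ Protoalgebraic (⊢⊤ K)
    PL-case PL⊆K = ¬Protoalgebraic-⊢⊤-by-relation (PL⊆K PL₃ PL₃-isPL) ≥ᵖ-compatible
      (λ { (x≡hi , _) → x≡hi }) mid mid (refl , refl) (refl , refl) (λ ())

    DM-case : DMᶜ ⊆ᶜ K → ¬ Protoalgebraic (⊢⊤ K)
    DM-case DM⊆K = ¬Protoalgebraic-⊢⊤-by-relation (DM⊆K K₃ K₃-isDM) ⊒-compatible
      [ (λ x≡hi → x≡hi) , (λ ()) ] lo mid (inj₂ refl) (inj₂ refl) (λ ())
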